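{- For all $n\ge 2$, $\overline{q}_n(123,213,312)=2n$.
   Context: For a positive integer $n$, let $\mathcal{S}_{n,n}$ denote the set of all permutations (words) $\pi=\pi_1\cdots\pi_{2n}$ of the multiset $\{1,1,2,2,\ldots,n,n\}$. A word $\pi$ contains a pattern $\sigma=\sigma_1\cdots\sigma_k$ if there are indices $i_1<\cdots<i_k$ such that $\pi_{i_a}=\pi_{i_b}$ iff $\sigma_a=\sigma_b$ and $\pi_{i_a}<\pi_{i_b}$ iff $\sigma_a<\sigma_b$ for all $a,b$; otherwise $\pi$ avoids $\sigma$. The quasi-Stirling permutations $\overline{\mathcal{Q}}_n$ are the $\pi\in\mathcal{S}_{n,n}$ avoiding both $1212$ and $2121$. For a set $\Lambda$ of patterns, $\overline{\mathcal{Q}}_n(\Lambda)$ is the set of $\pi\in\overline{\mathcal{Q}}_n$ avoiding every pattern in $\Lambda$, and $\overline{q}_n(\Lambda)=|\overline{\mathcal{Q}}_n(\Lambda)|$. -}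

module Defs where

open import Data.Nat using (ℕ; suc; _<_)
open import Data.List using (List; []; _∷_; length; zip; map; upTo; concatMap)
open import Data.List.Membership.Propositional using (_∈_)
open import Data.List.Relation.Binary.Sublist.Propositional using (_⊆_)
open import Data.List.Relation.Binary.Permutation.Propositional using (_↭_)
open import Data.Product using (_×_; _,_; ∃)
open import Function.Bundles using (_⇔_)
open import Relation.Binary.PropositionalEquality using (_≡_)
open import Relation.Nullary using (¬_)

Word : Set
Word = List ℕ

-- τ is order-isomorphic to σ: same length, and for every two positions
-- (ranging over all pairs of positions, read off from zip τ σ) the
-- equalities and the strict comparisons agree.
OrderIso : Word → Word → Set
OrderIso τ σ =
  length τ ≡ length σ ×
  (∀ {a b c d} → (a , c) ∈ zip τ σ → (b , d) ∈ zip τ σ →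
     (a ≡ b ⇔ c ≡ d) × (a < b ⇔ c < d))

Contains : Word → Word → Set
Contains π σ = ∃ λ τ → (τ ⊆ π) × OrderIso τ σ

Avoids : Word → Word → Set
Avoids π σ = ¬ Contains π σ

doubled : ℕ → List ℕ
doubled n = concatMap (λ k → k ∷ k ∷ []) (map suc (upTo n))

InS : ℕ → Word → Set
InS n π = π ↭ doubled n

p1212 p2121 : Word
p1212 = 1 ∷ 2 ∷ 1 ∷ 2 ∷ []
p2121 = 2 ∷ 1 ∷ 2 ∷ 1 ∷ []

QuasiStirling : ℕ → Word → Set
QuasiStirling n π = InS n π × Avoids π p1212 × Avoids π p2121

AvoidsAll : Word → List Word → Set
AvoidsAll π Λ = ∀ {σ} → σ ∈ Λ → Avoids π σ

QS-Avoiding : ℕ → List Word → Word → Set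
QS-Avoiding n Λ π = QuasiStirling n π × AvoidsAll π Λ

open import Data.List.Relation.Unary.Unique.Propositional using (Unique)

HasCard : (Word → Set) → ℕ → Set
HasCard P k = ∃ λ (L : List Word) →
  Unique L × (∀ π → (π ∈ L ⇔ P π)) × length L ≡ k

p123 p213 p312 : Word
p123 = 1 ∷ 2 ∷ 3 ∷ []
p213 = 2 ∷ 1 ∷ 3 ∷ []
p312 = 3 ∷ 1 ∷ 2 ∷ []

-- Let n be the largest letter of π and write π = u n w n z. Reading the second n as the
-- largest letter of a pattern, avoidance of 123 and 213 makes all letters of u w equal;
-- reading the first n as the largest letter, avoidance of 312 makes w z weakly decreasing.
-- Every value occurs twice, so u w has at most two letters, and avoidance of 1212 and 2121
-- excludes w = a and u = w = a. Hence π is c n n followed by the remaining letters in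
-- weakly decreasing order, where c is empty, a or a a with a < n (1 + 2(n − 1) words), or
-- π = n m m n followed by the remaining letters in weakly decreasing order, m = n − 1.
-- All 2n of these words avoid the five patterns.

module Submission where

open import Defs
open import Data.Nat using (ℕ; zero; suc; _≤_; _<_; _≥_; _+_; _*_; s≤s; z<s; s<s; _≟_)
open import Data.Nat.Properties
  using ( ≤-refl; ≤-reflexive; ≤-antisym; ≤-pred; ≤-totalOrder; ≤⇒≯; ≮⇒≥; <-cmp; <-irrefl; <-asym; <-trans
        ; <-≤-trans; <⇒≢; n<1+n; m≤n⇒m≤1+n; 1+n≰n; 1+n≢n; suc-injective
        ; module ≤-Reasoning )
open import Data.List using (List; []; _∷_; [_]; _++_; length; map; zip; filter; upTo; downFrom; concatMap)
open import Data.List.Properties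
  using ( ++-assoc; map-++; concatMap-++; upTo-∷ʳ; length-map; length-++; length-downFrom
        ; filter-accept; filter-reject; filter-none; ∷-injectiveˡ; ∷-injectiveʳ )
open import Data.List.Membership.Propositional using (_∈_; _∉_)
open import Data.List.Membership.Propositional.Properties using (∈-++⁻; ∈-++⁺ˡ; ∈-++⁺ʳ; ∈-map⁺; ∈-map⁻; ∈-∃++)
open import Data.List.Relation.Unary.Any using (here; there)
open import Data.List.Relation.Unary.All as All using (All; []; _∷_)
open import Data.List.Relation.Unary.All.Properties using (¬Any⇒All¬)
open import Data.List.Relation.Unary.AllPairs using (AllPairs; []; _∷_)
open import Data.List.Relation.Unary.Linked.Properties using (AllPairs⇒Linked)
open import Data.List.Relation.Unary.Unique.Propositional using (Unique)
import Data.List.Relation.Unary.Unique.Propositional.Properties as Unique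
open import Data.List.Relation.Unary.Sorted.TotalOrder.Properties using (↗↭↗⇒≋)
open import Data.List.Relation.Binary.Sublist.Propositional
  using (_⊆_; []; _∷_; _∷ʳ_; ⊆-refl; ⊆-trans; from∈; lookup)
open import Data.List.Relation.Binary.Sublist.Propositional.Properties
  using (All-resp-⊆; length-mono-≤; filter⁺; ∷ˡ⁻; ∷ʳ⁻; ∷⁻; ++⁺; ++⁺ˡ; ++⁺ʳ; []⊆-universal)
open import Data.List.Relation.Binary.Sublist.Heterogeneous.Properties using (take-Sublist)
open import Data.List.Relation.Binary.Permutation.Propositional
  using (_↭_; ↭-refl; ↭-sym; ↭-trans; ↭-prep; ↭-swap; ↭⇒↭ₛ)
open import Data.List.Relation.Binary.Permutation.Propositional.Properties
  using (∈-resp-↭; ↭-length; drop-∷; drop-mid; shift; shifts; filter-↭; ++-comm; ¬x∷xs↭[])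
open import Data.List.Relation.Binary.Pointwise using (Pointwise-≡⇒≡)
open import Relation.Binary.Properties.TotalOrder ≤-totalOrder using (≥-totalOrder)
open import Data.Product using (∃; _×_; _,_; proj₁; proj₂; map₂; uncurry)
open import Data.Sum using (inj₁; inj₂)
open import Data.Empty using (⊥; ⊥-elim)
open import Function using (_∘_)
open import Function.Bundles using (_⇔_; mk⇔; Equivalence)
open import Function.Construct.Composition using (_⇔-∘_)
open import Function.Construct.Symmetry using (⇔-sym)
open import Relation.Nullary using (¬_; yes; no)
open import Data.Nat.Tactic.RingSolver using (solve-∀)
open import Relation.Binary.Definitions using (tri<; tri≈; tri>)
open import Relation.Binary.PropositionalEquality
  using (_≡_; _≢_; refl; sym; trans; cong; cong₂; subst; subst₂; module ≡-Reasoning)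

-- Patterns as conditions on letters

pattern #0 = here refl
pattern #1 = there #0
pattern #2 = there #1
pattern #3 = there #2

No123-213 No312 NoAbab Admissible : Word → Set
No123-213 π = ∀ {a b c} → a ∷ b ∷ c ∷ [] ⊆ π → a < c → b < c → a ≡ b
No312 π = ∀ {a b c} → a ∷ b ∷ c ∷ [] ⊆ π → b < c → c < a → ⊥
NoAbab π = ∀ {a b} → a ∷ b ∷ a ∷ b ∷ [] ⊆ π → a ≡ b
Admissible π = No123-213 π × No312 π × NoAbab π

StrictlyMonotoneOn : Word → (ℕ → ℕ) → Set
StrictlyMonotoneOn σ f = ∀ {s t} → s ∈ σ → t ∈ σ → s < t → f s < f t

∈-zip-map : ∀ (f : ℕ → ℕ) σ {a c} → (a , c) ∈ zip (map f σ) σ → a ≡ f c × c ∈ σ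
∈-zip-map f (s ∷ σ) (here refl) = refl , here refl
∈-zip-map f (s ∷ σ) (there p)   = map₂ there (∈-zip-map f σ p)

orderIso-map : ∀ (f : ℕ → ℕ) σ → StrictlyMonotoneOn σ f → OrderIso (map f σ) σ
orderIso-map f σ mono = length-map f σ , λ p q → compare (∈-zip-map f σ p) (∈-zip-map f σ q)
  where
  compare : ∀ {a b c d} → a ≡ f c × c ∈ σ → b ≡ f d × d ∈ σ →
            (a ≡ b ⇔ c ≡ d) × (a < b ⇔ c < d)
  compare {c = c} {d} (refl , c∈σ) (refl , d∈σ) = mk⇔ reflects-≡ (cong f) , mk⇔ reflects-< (mono c∈σ d∈σ)
    where
    reflects-≡ : f c ≡ f d → c ≡ d
    reflects-≡ fc≡fd with <-cmp c d
    ... | tri< c<d _ _ = ⊥-elim (<⇒≢ (mono c∈σ d∈σ c<d) fc≡fd)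
    ... | tri≈ _ c≡d _ = c≡d
    ... | tri> _ _ d<c = ⊥-elim (<⇒≢ (mono d∈σ c∈σ d<c) (sym fc≡fd))
    reflects-< : f c < f d → c < d
    reflects-< fc<fd with <-cmp c d
    ... | tri< c<d _ _ = c<d
    ... | tri≈ _ refl _ = ⊥-elim (<-irrefl refl fc<fd)
    ... | tri> _ _ d<c = ⊥-elim (<-asym fc<fd (mono d∈σ c∈σ d<c))

Letter : ℕ → Set
Letter s = s ∈ 1 ∷ 2 ∷ 3 ∷ []

relabel : ℕ → ℕ → ℕ → ℕ → ℕ
relabel a b c 1 = a
relabel a b c 2 = b
relabel a b c _ = c

relabel-monotone : ∀ {a b c s t} → a < b → b < c → Letter s → Letter t → s < t →
                   relabel a b c s < relabel a b c t
relabel-monotone a<b b<c #0 #1 _ = a<b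
relabel-monotone a<b b<c #0 #2 _ = <-trans a<b b<c
relabel-monotone a<b b<c #1 #2 _ = b<c
relabel-monotone _ _ #0 #0 (s≤s ())
relabel-monotone _ _ #1 #0 (s≤s ())
relabel-monotone _ _ #1 #1 (s≤s (s≤s ()))
relabel-monotone _ _ #2 #0 (s≤s ())
relabel-monotone _ _ #2 #1 (s≤s (s≤s ()))
relabel-monotone _ _ #2 #2 (s≤s (s≤s (s≤s ())))

orderIso-relabel : ∀ {a b c} σ → a < b → b < c → All Letter σ →
                   OrderIso (map (relabel a b c) σ) σ
orderIso-relabel σ a<b b<c letters = orderIso-map _ σ λ s∈σ t∈σ →
  relabel-monotone a<b b<c (All.lookup letters s∈σ) (All.lookup letters t∈σ)

module Reflect (τ σ : Word) (iso : OrderIso τ σ) where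

  iso-≡ : ∀ {a b c d} → (a , c) ∈ zip τ σ → (b , d) ∈ zip τ σ → c ≡ d → a ≡ b
  iso-≡ p q = Equivalence.from (proj₁ (proj₂ iso p q))

  iso-< : ∀ {a b c d} → (a , c) ∈ zip τ σ → (b , d) ∈ zip τ σ → c < d → a < b
  iso-< p q = Equivalence.from (proj₂ (proj₂ iso p q))

Occurrence₃ : Word → Word → Set
Occurrence₃ π σ = ∃ λ a → ∃ λ b → ∃ λ c → a ∷ b ∷ c ∷ [] ⊆ π × OrderIso (a ∷ b ∷ c ∷ []) σ

Occurrence₄ : Word → Word → Set
Occurrence₄ π σ = ∃ λ a → ∃ λ b → ∃ λ c → ∃ λ d → a ∷ b ∷ c ∷ d ∷ [] ⊆ π × OrderIso (a ∷ b ∷ c ∷ d ∷ []) σ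

contains₃ : ∀ {π x y z} → Contains π (x ∷ y ∷ z ∷ []) → Occurrence₃ π (x ∷ y ∷ z ∷ [])
contains₃ ((a ∷ b ∷ c ∷ []) , τ⊆π , iso) = a , b , c , τ⊆π , iso
contains₃ ([] , _ , () , _)
contains₃ ((_ ∷ []) , _ , () , _)
contains₃ ((_ ∷ _ ∷ []) , _ , () , _)
contains₃ ((_ ∷ _ ∷ _ ∷ _ ∷ _) , _ , () , _)

contains₄ : ∀ {π x y z t} → Contains π (x ∷ y ∷ z ∷ t ∷ []) → Occurrence₄ π (x ∷ y ∷ z ∷ t ∷ [])
contains₄ ((a ∷ b ∷ c ∷ d ∷ []) , τ⊆π , iso) = a , b , c , d , τ⊆π , iso
contains₄ ([] , _ , () , _)
contains₄ ((_ ∷ []) , _ , () , _)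
contains₄ ((_ ∷ _ ∷ []) , _ , () , _)
contains₄ ((_ ∷ _ ∷ _ ∷ []) , _ , () , _)
contains₄ ((_ ∷ _ ∷ _ ∷ _ ∷ _ ∷ _) , _ , () , _)

module _ {π : Word} where

  avoids⇒no123-213 : Avoids π p123 → Avoids π p213 → No123-213 π
  avoids⇒no123-213 av123 av213 {a} {b} {c} abc⊆π a<c b<c with <-cmp a b
  ... | tri< a<b _ _ = ⊥-elim (av123 (_ , abc⊆π , orderIso-relabel p123 a<b b<c (#0 ∷ #1 ∷ #2 ∷ [])))
  ... | tri≈ _ a≡b _ = a≡b
  ... | tri> _ _ b<a = ⊥-elim (av213 (_ , abc⊆π , orderIso-relabel p213 b<a a<c (#1 ∷ #0 ∷ #2 ∷ [])))

  avoids⇒no312 : Avoids π p312 → No312 π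
  avoids⇒no312 av312 abc⊆π b<c c<a = av312 (_ , abc⊆π , orderIso-relabel p312 b<c c<a (#2 ∷ #0 ∷ #1 ∷ []))

  avoids⇒noAbab : Avoids π p1212 → Avoids π p2121 → NoAbab π
  avoids⇒noAbab av1212 av2121 {a} {b} abab⊆π with <-cmp a b
  ... | tri< a<b _ _ =
    ⊥-elim (av1212 (_ , abab⊆π , orderIso-relabel p1212 a<b (n<1+n b) (#0 ∷ #1 ∷ #0 ∷ #1 ∷ [])))
  ... | tri≈ _ a≡b _ = a≡b
  ... | tri> _ _ b<a =
    ⊥-elim (av2121 (_ , abab⊆π , orderIso-relabel p2121 b<a (n<1+n a) (#1 ∷ #0 ∷ #1 ∷ #0 ∷ [])))

  no123-213⇒avoids123 : No123-213 π → Avoids π p123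
  no123-213⇒avoids123 free occ with contains₃ occ
  ... | a , b , c , abc⊆π , iso = let open Reflect (a ∷ b ∷ c ∷ []) p123 iso in
    <⇒≢ (iso-< #0 #1 (s<s z<s)) (free abc⊆π (iso-< #0 #2 (s<s z<s)) (iso-< #1 #2 (s<s (s<s z<s))))

  no123-213⇒avoids213 : No123-213 π → Avoids π p213
  no123-213⇒avoids213 free occ with contains₃ occ
  ... | a , b , c , abc⊆π , iso = let open Reflect (a ∷ b ∷ c ∷ []) p213 iso in
    <⇒≢ (iso-< #1 #0 (s<s z<s)) (sym (free abc⊆π (iso-< #0 #2 (s<s (s<s z<s))) (iso-< #1 #2 (s<s z<s))))

  no312⇒avoids312 : No312 π → Avoids π p312
  no312⇒avoids312 free occ with contains₃ occ
  ... | a , b , c , abc⊆π , iso = let open Reflect (a ∷ b ∷ c ∷ []) p312 iso in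
    free abc⊆π (iso-< #1 #2 (s<s z<s)) (iso-< #2 #0 (s<s (s<s z<s)))

  noAbab⇒avoids1212 : NoAbab π → Avoids π p1212
  noAbab⇒avoids1212 free occ with contains₄ occ
  ... | a , b , c , d , abcd⊆π , iso = let open Reflect (a ∷ b ∷ c ∷ d ∷ []) p1212 iso in
    <⇒≢ (iso-< #0 #1 (s<s z<s))
        (free (subst₂ (λ c d → a ∷ b ∷ c ∷ d ∷ [] ⊆ π)
                      (sym (iso-≡ #0 #2 refl)) (sym (iso-≡ #1 #3 refl)) abcd⊆π))

  noAbab⇒avoids2121 : NoAbab π → Avoids π p2121
  noAbab⇒avoids2121 free occ with contains₄ occ
  ... | a , b , c , d , abcd⊆π , iso = let open Reflect (a ∷ b ∷ c ∷ d ∷ []) p2121 iso in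
    <⇒≢ (iso-< #1 #0 (s<s z<s))
        (sym (free (subst₂ (λ c d → a ∷ b ∷ c ∷ d ∷ [] ⊆ π)
                           (sym (iso-≡ #0 #2 refl)) (sym (iso-≡ #1 #3 refl)) abcd⊆π)))

module _ {A : Set} {R : A → A → Set} where

  AllPairs-resp-⊆ : ∀ {xs ys} → AllPairs R ys → xs ⊆ ys → AllPairs R xs
  AllPairs-resp-⊆ [] [] = []
  AllPairs-resp-⊆ (_ ∷ rys) (_ ∷ʳ xs⊆ys) = AllPairs-resp-⊆ rys xs⊆ys
  AllPairs-resp-⊆ (ry ∷ rys) (refl ∷ xs⊆ys) = All-resp-⊆ xs⊆ys ry ∷ AllPairs-resp-⊆ rys xs⊆ys

  AllPairs-fromSublists : ∀ xs → (∀ {x y} → x ∷ y ∷ [] ⊆ xs → R x y) → AllPairs R xs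
  AllPairs-fromSublists [] _ = []
  AllPairs-fromSublists (x ∷ xs) r =
    All.tabulate (λ y∈xs → r (refl ∷ from∈ y∈xs)) ∷ AllPairs-fromSublists xs (r ∘ (x ∷ʳ_))

NonIncreasing : Word → Set
NonIncreasing = AllPairs _≥_

nonIncreasing-↭-unique : ∀ {xs ys} → NonIncreasing xs → NonIncreasing ys → xs ↭ ys → xs ≡ ys
nonIncreasing-↭-unique xs↘ ys↘ xs↭ys =
  Pointwise-≡⇒≡ (↗↭↗⇒≋ ≥-totalOrder (AllPairs⇒Linked xs↘) (AllPairs⇒Linked ys↘) (↭⇒↭ₛ xs↭ys))

nonIncreasing-pair : ∀ {xs a b} → NonIncreasing xs → a ∷ b ∷ [] ⊆ xs → b ≤ a
nonIncreasing-pair xs↘ ab⊆xs with AllPairs-resp-⊆ xs↘ ab⊆xs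
... | (b≤a ∷ []) ∷ _ = b≤a

nonIncreasing-head : ∀ {x xs y} → NonIncreasing (x ∷ xs) → y ∈ x ∷ xs → y ≤ x
nonIncreasing-head _ (here refl) = ≤-refl
nonIncreasing-head (x≥xs ∷ _) (there y∈xs) = All.lookup x≥xs y∈xs

module _ {xs : Word} (xs↘ : NonIncreasing xs) where

  nonIncreasing-no-ascent : ∀ {b c} → b ∷ c ∷ [] ⊆ xs → b < c → ⊥
  nonIncreasing-no-ascent bc⊆xs = ≤⇒≯ (nonIncreasing-pair xs↘ bc⊆xs)

  nonIncreasing-sandwich : ∀ {a b} → a ∷ b ∷ a ∷ [] ⊆ xs → a ≡ b
  nonIncreasing-sandwich aba⊆xs =
    ≤-antisym (nonIncreasing-pair xs↘ (∷ˡ⁻ aba⊆xs)) (nonIncreasing-pair xs↘ (take-Sublist 2 aba⊆xs))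

count : ℕ → Word → ℕ
count a = length ∘ filter (a ≟_)

count-here : ∀ a xs → count a (a ∷ xs) ≡ suc (count a xs)
count-here a xs = cong length (filter-accept (a ≟_) refl)

module _ {a : ℕ} where

  count-↭ : ∀ {xs ys} → xs ↭ ys → count a xs ≡ count a ys
  count-↭ xs↭ys = ↭-length (filter-↭ (a ≟_) xs↭ys)

  count-mono : ∀ {xs ys} → xs ⊆ ys → count a xs ≤ count a ys
  count-mono xs⊆ys = length-mono-≤ (filter⁺ (a ≟_) (a ≟_) (λ { refl a≡x → a≡x }) xs⊆ys)

  count-there : ∀ {x xs} → a ≢ x → count a (x ∷ xs) ≡ count a xs
  count-there a≢x = cong length (filter-reject (a ≟_) a≢x)

  count-∉ : ∀ {xs} → a ∉ xs → count a xs ≡ 0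
  count-∉ {xs} a∉xs = cong length (filter-none (a ≟_) (¬Any⇒All¬ xs a∉xs))

  count>0⇒∈ : ∀ xs → 0 < count a xs → a ∈ xs
  count>0⇒∈ (x ∷ xs) pos with a ≟ x
  ... | yes a≡x = here a≡x
  ... | no a≢x = there (count>0⇒∈ xs (subst (0 <_) (count-there a≢x) pos))

delete : ℕ → Word → Word
delete a [] = []
delete a (x ∷ xs) with a ≟ x
... | yes _ = xs
... | no _ = x ∷ delete a xs

delete-⊆ : ∀ a xs → delete a xs ⊆ xs
delete-⊆ a [] = []
delete-⊆ a (x ∷ xs) with a ≟ x
... | yes _ = x ∷ʳ ⊆-refl
... | no _ = refl ∷ delete-⊆ a xs

delete-↭ : ∀ {a xs} → a ∈ xs → xs ↭ a ∷ delete a xs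
delete-↭ {a} {x ∷ xs} a∈ with a ≟ x | a∈
... | yes refl | _ = ↭-refl
... | no a≢x | here a≡x = ⊥-elim (a≢x a≡x)
... | no _ | there a∈xs = ↭-trans (↭-prep x (delete-↭ a∈xs)) (↭-swap x a ↭-refl)

↭-delete : ∀ {a xs ys} → a ∷ xs ↭ ys → xs ↭ delete a ys
↭-delete a∷xs↭ys = drop-∷ (↭-trans a∷xs↭ys (delete-↭ (∈-resp-↭ a∷xs↭ys (here refl))))

doubled↓ : ℕ → Word
doubled↓ zero = []
doubled↓ (suc m) = suc m ∷ suc m ∷ doubled↓ m

∈-doubled↓⇒≤ : ∀ {a} m → a ∈ doubled↓ m → a ≤ m
∈-doubled↓⇒≤ (suc m) (here refl) = ≤-refl
∈-doubled↓⇒≤ (suc m) (there (here refl)) = ≤-refl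
∈-doubled↓⇒≤ (suc m) (there (there a∈)) = m≤n⇒m≤1+n (∈-doubled↓⇒≤ m a∈)

doubled↓-nonIncreasing : ∀ m → NonIncreasing (doubled↓ m)
doubled↓-nonIncreasing zero = []
doubled↓-nonIncreasing (suc m) = (≤-refl ∷ below) ∷ below ∷ doubled↓-nonIncreasing m
  where
  below : All (_≤ suc m) (doubled↓ m)
  below = All.tabulate (m≤n⇒m≤1+n ∘ ∈-doubled↓⇒≤ m)

count-doubled↓ : ∀ {a} m → a ∈ doubled↓ m → count a (doubled↓ m) ≡ 2
count-doubled↓ {a} (suc m) a∈ with a ≟ suc m
... | yes refl = begin
  count a (a ∷ a ∷ doubled↓ m) ≡⟨ count-here a (a ∷ doubled↓ m) ⟩
  suc (count a (a ∷ doubled↓ m)) ≡⟨ cong suc (count-here a (doubled↓ m)) ⟩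
  suc (suc (count a (doubled↓ m))) ≡⟨ cong (suc ∘ suc) (count-∉ (1+n≰n ∘ ∈-doubled↓⇒≤ m)) ⟩
  2 ∎
  where open ≡-Reasoning
... | no a≢ = begin
  count a (suc m ∷ suc m ∷ doubled↓ m) ≡⟨ count-there a≢ ⟩
  count a (suc m ∷ doubled↓ m) ≡⟨ count-there a≢ ⟩
  count a (doubled↓ m) ≡⟨ count-doubled↓ m (lower a∈) ⟩
  2 ∎
  where
  open ≡-Reasoning
  lower : a ∈ suc m ∷ suc m ∷ doubled↓ m → a ∈ doubled↓ m
  lower (here a≡) = ⊥-elim (a≢ a≡)
  lower (there (here a≡)) = ⊥-elim (a≢ a≡)
  lower (there (there a∈)) = a∈

second-copy : ∀ {a xs} m → a ∷ xs ↭ doubled↓ m → a ∈ xs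
second-copy {a} {xs} m a∷xs↭ = count>0⇒∈ xs (≤-reflexive (sym (suc-injective count≡2)))
  where
  open ≡-Reasoning
  count≡2 : suc (count a xs) ≡ 2
  count≡2 = begin
    suc (count a xs)        ≡⟨ count-here a xs ⟨
    count a (a ∷ xs)        ≡⟨ count-↭ a∷xs↭ ⟩
    count a (doubled↓ m)    ≡⟨ count-doubled↓ m (∈-resp-↭ a∷xs↭ (here refl)) ⟩
    2                       ∎

no-third-copy : ∀ {a xs} m → a ∷ a ∷ a ∷ [] ⊆ xs → xs ↭ doubled↓ m → ⊥
no-third-copy {a} {xs} m aaa⊆xs xs↭ = 1+n≰n (begin
  3                       ≡⟨ count≡3 ⟨
  count a (a ∷ a ∷ a ∷ []) ≤⟨ count-mono {a} aaa⊆xs ⟩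
  count a xs               ≡⟨ count-↭ xs↭ ⟩
  count a (doubled↓ m)     ≡⟨ count-doubled↓ m (∈-resp-↭ xs↭ (lookup aaa⊆xs (here refl))) ⟩
  2                        ∎)
  where
  open ≤-Reasoning
  count≡3 : count a (a ∷ a ∷ a ∷ []) ≡ 3
  count≡3 = trans (count-here a _) (cong suc (trans (count-here a _) (cong suc (count-here a []))))

doubled-suc : ∀ m → doubled (suc m) ≡ doubled m ++ suc m ∷ suc m ∷ []
doubled-suc m = begin
  concatMap pair (map suc (upTo (suc m)))       ≡⟨ cong (concatMap pair ∘ map suc) (upTo-∷ʳ m) ⟨
  concatMap pair (map suc (upTo m ++ [ m ]))     ≡⟨ cong (concatMap pair) (map-++ suc (upTo m) [ m ]) ⟩
  concatMap pair (map suc (upTo m) ++ [ suc m ]) ≡⟨ concatMap-++ pair (map suc (upTo m)) [ suc m ] ⟩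
  doubled m ++ suc m ∷ suc m ∷ []                ∎
  where
  open ≡-Reasoning
  pair : ℕ → List ℕ
  pair k = k ∷ k ∷ []

doubled↭doubled↓ : ∀ m → doubled m ↭ doubled↓ m
doubled↭doubled↓ zero = ↭-refl
doubled↭doubled↓ (suc m) rewrite doubled-suc m =
  ↭-trans (++-comm (doubled m) _) (↭-prep (suc m) (↭-prep (suc m) (doubled↭doubled↓ m)))

nonIncreasing-⊆-doubled↓ : ∀ {xs} m → xs ⊆ doubled↓ m → NonIncreasing xs
nonIncreasing-⊆-doubled↓ m = AllPairs-resp-⊆ (doubled↓-nonIncreasing m)

values : ℕ → List ℕ
values m = map suc (downFrom m)

∈-values⇔ : ∀ {a} m → a ∈ values m ⇔ a ∈ doubled↓ m
∈-values⇔ m = mk⇔ (to m) (from m)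
  where
  to : ∀ {a} m → a ∈ values m → a ∈ doubled↓ m
  to (suc m) (here refl) = here refl
  to (suc m) (there a∈) = there (there (to m a∈))
  from : ∀ {a} m → a ∈ doubled↓ m → a ∈ values m
  from (suc m) (here refl) = here refl
  from (suc m) (there (here refl)) = here refl
  from (suc m) (there (there a∈)) = there (from m a∈)

-- Admissible words

admissible-∷ : ∀ {x w} → Admissible w →
  (∀ {b c} → b ∷ c ∷ [] ⊆ w → x < c → b < c → x ≡ b) →
  (∀ {b c} → b ∷ c ∷ [] ⊆ w → b < c → c < x → ⊥) →
  (∀ {b} → b ∷ x ∷ b ∷ [] ⊆ w → x ≡ b) →
  Admissible (x ∷ w)
admissible-∷ {x} {w} (free123 , free312 , freeAbab) first123 first312 firstAbab =
  free123′ , free312′ , freeAbab′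
  where
  free123′ : No123-213 (x ∷ w)
  free123′ (_ ∷ʳ abc⊆w) = free123 abc⊆w
  free123′ (refl ∷ bc⊆w) = first123 bc⊆w
  free312′ : No312 (x ∷ w)
  free312′ (_ ∷ʳ abc⊆w) = free312 abc⊆w
  free312′ (refl ∷ bc⊆w) = first312 bc⊆w
  freeAbab′ : NoAbab (x ∷ w)
  freeAbab′ (_ ∷ʳ abab⊆w) = freeAbab abab⊆w
  freeAbab′ (refl ∷ bab⊆w) = firstAbab bab⊆w

module _ {xs : Word} (xs↘ : NonIncreasing xs) where

  nonIncreasing⇒admissible : Admissible xs
  nonIncreasing⇒admissible =
    (λ abc⊆xs _ b<c → ⊥-elim (nonIncreasing-no-ascent xs↘ (∷ˡ⁻ abc⊆xs) b<c)) ,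
    (λ abc⊆xs b<c _ → nonIncreasing-no-ascent xs↘ (∷ˡ⁻ abc⊆xs) b<c) ,
    (λ abab⊆xs → nonIncreasing-sandwich xs↘ (take-Sublist 3 abab⊆xs))

  ∷-admissible : ∀ x → Admissible (x ∷ xs)
  ∷-admissible x = admissible-∷ nonIncreasing⇒admissible
    (λ bc⊆xs _ b<c → ⊥-elim (nonIncreasing-no-ascent xs↘ bc⊆xs b<c))
    (λ bc⊆xs b<c _ → nonIncreasing-no-ascent xs↘ bc⊆xs b<c)
    (sym ∘ nonIncreasing-sandwich xs↘)

  ∷∷-admissible : ∀ x → Admissible (x ∷ x ∷ xs)
  ∷∷-admissible x = admissible-∷ (∷-admissible x) first123 first312 firstAbab
    where
    first123 : ∀ {b c} → b ∷ c ∷ [] ⊆ x ∷ xs → x < c → b < c → x ≡ b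
    first123 (refl ∷ _) _ _ = refl
    first123 (_ ∷ʳ bc⊆xs) _ b<c = ⊥-elim (nonIncreasing-no-ascent xs↘ bc⊆xs b<c)
    first312 : ∀ {b c} → b ∷ c ∷ [] ⊆ x ∷ xs → b < c → c < x → ⊥
    first312 (refl ∷ _) x<c c<x = <-asym x<c c<x
    first312 (_ ∷ʳ bc⊆xs) b<c _ = nonIncreasing-no-ascent xs↘ bc⊆xs b<c
    firstAbab : ∀ {b} → b ∷ x ∷ b ∷ [] ⊆ x ∷ xs → x ≡ b
    firstAbab (refl ∷ _) = refl
    firstAbab (_ ∷ʳ bxb⊆xs) = sym (nonIncreasing-sandwich xs↘ bxb⊆xs)

singleWord doubleWord : ℕ → ℕ → Word
singleWord m a = a ∷ suc m ∷ suc m ∷ delete a (doubled↓ m)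
doubleWord m a = a ∷ a ∷ suc m ∷ suc m ∷ delete a (delete a (doubled↓ m))

spikeWord : ℕ → Word
spikeWord k = suc (suc k) ∷ suc k ∷ suc k ∷ suc (suc k) ∷ doubled↓ k

spike-admissible : ∀ k → Admissible (spikeWord k)
spike-admissible k = admissible-∷ (∷∷-admissible n∷tail↘ m) first123 first312 firstAbab
  where
  m n : ℕ
  m = suc k
  n = suc m
  tail↘ : NonIncreasing (doubled↓ k)
  tail↘ = doubled↓-nonIncreasing k
  n∷tail↘ : NonIncreasing (n ∷ doubled↓ k)
  n∷tail↘ = nonIncreasing-⊆-doubled↓ n (refl ∷ _ ∷ʳ _ ∷ʳ _ ∷ʳ ⊆-refl)
  below-m : ∀ {x xs} → x ∷ xs ⊆ doubled↓ k → x < m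
  below-m x∷xs⊆ = s≤s (∈-doubled↓⇒≤ k (lookup x∷xs⊆ (here refl)))
  into-tail : ∀ {x xs} → x ≢ m → x ≢ n → x ∷ xs ⊆ m ∷ m ∷ n ∷ doubled↓ k → x ∷ xs ⊆ doubled↓ k
  into-tail x≢m x≢n = ∷ʳ⁻ x≢n ∘ ∷ʳ⁻ x≢m ∘ ∷ʳ⁻ x≢m
  below-into-tail : ∀ {x xs} → x < m → x ∷ xs ⊆ m ∷ m ∷ n ∷ doubled↓ k → x ∷ xs ⊆ doubled↓ k
  below-into-tail x<m = into-tail (<⇒≢ x<m) (<⇒≢ (<-trans x<m (n<1+n m)))
  first123 : ∀ {b c} → b ∷ c ∷ [] ⊆ m ∷ m ∷ n ∷ doubled↓ k → n < c → b < c → n ≡ b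
  first123 {c = c} bc⊆ n<c _ = ⊥-elim (<-asym (<-trans (n<1+n m) n<c) c<m)
    where
    c<m : c < m
    c<m = below-m (into-tail (<⇒≢ (<-trans (n<1+n m) n<c) ∘ sym) (<⇒≢ n<c ∘ sym) (∷ˡ⁻ bc⊆))
  first312 : ∀ {b c} → b ∷ c ∷ [] ⊆ m ∷ m ∷ n ∷ doubled↓ k → b < c → c < n → ⊥
  first312 bc⊆ b<c c<n =
    nonIncreasing-no-ascent tail↘ (below-into-tail (<-≤-trans b<c (≤-pred c<n)) bc⊆) b<c
  firstAbab : ∀ {b} → b ∷ n ∷ b ∷ [] ⊆ m ∷ m ∷ n ∷ doubled↓ k → n ≡ b
  firstAbab {b} bnb⊆ = ⊥-elim (<-asym (n<1+n m) (below-m (∷ˡ⁻ (below-into-tail b<m bnb⊆))))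
    where
    b<m : b < m
    b<m = below-m (∷⁻ (∷ʳ⁻ 1+n≢n (∷ʳ⁻ 1+n≢n (∷ˡ⁻ bnb⊆))))

-- Classification of admissible permutations of {1,1,…,m+1,m+1}

data Candidate : ℕ → Word → Set where
  sorted : ∀ {m} → Candidate m (doubled↓ (suc m))
  single : ∀ {m a} → a ∈ doubled↓ m → Candidate m (singleWord m a)
  double : ∀ {m a} → a ∈ doubled↓ m → Candidate m (doubleWord m a)
  spike  : ∀ {k} → Candidate (suc k) (spikeWord k)

candidate-sound : ∀ {m π} → Candidate m π → π ↭ doubled↓ (suc m) × Admissible π
candidate-sound {m} sorted = ↭-refl , ∷∷-admissible (doubled↓-nonIncreasing m) (suc m)
candidate-sound {m} (single {a = a} a∈) =
  ↭-trans (↭-sym (shift a (suc m ∷ suc m ∷ []) _)) (↭-prep _ (↭-prep _ (↭-sym (delete-↭ a∈)))) ,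
  ∷-admissible (nonIncreasing-⊆-doubled↓ (suc m) (refl ∷ refl ∷ delete-⊆ a _)) a
candidate-sound {m} (double {a = a} a∈) =
  ↭-trans (shifts (a ∷ a ∷ []) (suc m ∷ suc m ∷ []))
          (↭-prep _ (↭-prep _ (↭-sym (↭-trans (delete-↭ a∈) (↭-prep a (delete-↭ a∈delete)))))) ,
  ∷∷-admissible (nonIncreasing-⊆-doubled↓ (suc m) (refl ∷ refl ∷ ⊆-trans (delete-⊆ a _) (delete-⊆ a _))) a
  where
  a∈delete : a ∈ delete a (doubled↓ m)
  a∈delete = second-copy m (↭-sym (delete-↭ a∈))
candidate-sound {suc k} spike = ↭-prep _ (shift _ (suc k ∷ suc k ∷ []) _) , spike-admissible k

split-first : ∀ {a} xs → a ∈ xs → ∃ λ u → ∃ λ r → xs ≡ u ++ a ∷ r × a ∉ u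
split-first {a} (x ∷ xs) a∈ with a ≟ x | a∈
... | yes refl | _ = [] , xs , refl , λ ()
... | no a≢x | here a≡x = ⊥-elim (a≢x a≡x)
... | no a≢x | there a∈xs with split-first xs a∈xs
...   | u , r , refl , a∉u = x ∷ u , r , refl , λ { (here a≡x) → a≢x a≡x ; (there a∈u) → a∉u a∈u }

SplitAtMax : ℕ → Word → Set
SplitAtMax m π = ∃ λ u → ∃ λ w → ∃ λ z →
  π ≡ u ++ suc m ∷ w ++ suc m ∷ z × u ++ w ++ z ↭ doubled↓ m

drop-mid-++ : ∀ {x : ℕ} u w {z ys} → u ++ w ++ x ∷ z ↭ x ∷ ys → u ++ w ++ z ↭ ys
drop-mid-++ u w {z} p =
  subst (_↭ _) (++-assoc u w z) (drop-mid (u ++ w) [] (subst (_↭ _) (sym (++-assoc u w _)) p))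

split-at-max : ∀ m {π} → π ↭ doubled↓ (suc m) → SplitAtMax m π
split-at-max m {π} π↭ with split-first π (∈-resp-↭ (↭-sym π↭) (here refl))
... | u , r , refl , n∉u with ∈-++⁻ u (∈-resp-↭ (↭-sym (drop-mid u [] π↭)) (here refl))
...   | inj₁ n∈u = ⊥-elim (n∉u n∈u)
...   | inj₂ n∈r with w , z , refl ← ∈-∃++ n∈r = u , w , z , refl , drop-mid-++ u w (drop-mid u [] π↭)

module AroundMax (m : ℕ) (u w z : Word)
  (rest↭ : u ++ w ++ z ↭ doubled↓ m)
  (adm : Admissible (u ++ suc m ∷ w ++ suc m ∷ z)) where

  rest-below-max : ∀ {x xs} → x ∷ xs ⊆ u ++ w ++ z → x < suc m
  rest-below-max x∷xs⊆ = s≤s (∈-doubled↓⇒≤ m (∈-resp-↭ rest↭ (lookup x∷xs⊆ (here refl))))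

  prefix⊆rest : u ++ w ⊆ u ++ w ++ z
  prefix⊆rest = ++⁺ (⊆-refl {x = u}) (++⁺ʳ z ⊆-refl)

  suffix⊆rest : w ++ z ⊆ u ++ w ++ z
  suffix⊆rest = ++⁺ˡ u ⊆-refl

  prefix-constant : AllPairs _≡_ (u ++ w)
  prefix-constant = AllPairs-fromSublists (u ++ w) λ xy⊆ →
    proj₁ adm (before-second-max xy⊆)
      (rest-below-max (⊆-trans xy⊆ prefix⊆rest)) (rest-below-max (∷ˡ⁻ (⊆-trans xy⊆ prefix⊆rest)))
    where
    before-second-max : ∀ {xs} → xs ⊆ u ++ w → xs ++ [ suc m ] ⊆ u ++ suc m ∷ w ++ suc m ∷ z
    before-second-max xs⊆ = subst (_ ⊆_) (++-assoc u (suc m ∷ w) (suc m ∷ z))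
      (++⁺ (⊆-trans xs⊆ (++⁺ (⊆-refl {x = u}) (suc m ∷ʳ ⊆-refl))) (refl ∷ []⊆-universal z))

  suffix-nonIncreasing : NonIncreasing (w ++ z)
  suffix-nonIncreasing = AllPairs-fromSublists (w ++ z) λ xy⊆ → ≮⇒≥ λ x<y →
    proj₁ (proj₂ adm) (after-first-max xy⊆) x<y (rest-below-max (∷ˡ⁻ (⊆-trans xy⊆ suffix⊆rest)))
    where
    after-first-max : ∀ {xs} → xs ⊆ w ++ z → suc m ∷ xs ⊆ u ++ suc m ∷ w ++ suc m ∷ z
    after-first-max xs⊆ = ++⁺ˡ u (refl ∷ ⊆-trans xs⊆ (++⁺ (⊆-refl {x = w}) (suc m ∷ʳ ⊆-refl)))

head-≤ : ∀ {m a xs} → a ∷ xs ↭ doubled↓ m → a ≤ m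
head-≤ {m} a∷xs↭ = ∈-doubled↓⇒≤ m (∈-resp-↭ a∷xs↭ (here refl))

⊆-triple : ∀ {a : ℕ} {xs} → a ∷ a ∷ a ∷ [] ⊆ a ∷ a ∷ a ∷ xs
⊆-triple = refl ∷ refl ∷ refl ∷ []⊆-universal _

classify : ∀ m u w z → u ++ w ++ z ↭ doubled↓ m → AllPairs _≡_ (u ++ w) → NonIncreasing (w ++ z) →
           NoAbab (u ++ suc m ∷ w ++ suc m ∷ z) → Candidate m (u ++ suc m ∷ w ++ suc m ∷ z)
classify m [] [] z rest↭ _ z↘ _
  with refl ← nonIncreasing-↭-unique z↘ (doubled↓-nonIncreasing m) rest↭ = sorted
classify m [] (a ∷ []) z rest↭ _ _ noAbab =
  ⊥-elim (<⇒≢ (s≤s (head-≤ rest↭)) (sym (noAbab (refl ∷ refl ∷ refl ∷ from∈ (second-copy m rest↭)))))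
classify zero [] (a ∷ b ∷ []) z rest↭ _ _ _ = ⊥-elim (¬x∷xs↭[] rest↭)
classify (suc k) [] (a ∷ b ∷ []) z rest↭ ((refl ∷ []) ∷ _) aaz↘@(_ ∷ _ ∷ z↘) _
  -- suc k occurs in a ∷ a ∷ z, whose first letter is its largest
  with refl ← ≤-antisym (head-≤ rest↭) (nonIncreasing-head aaz↘ (∈-resp-↭ (↭-sym rest↭) (here refl)))
  with refl ← nonIncreasing-↭-unique z↘ (doubled↓-nonIncreasing k) (drop-∷ (drop-∷ rest↭)) = spike
classify m [] (a ∷ b ∷ c ∷ w) z rest↭ ((refl ∷ refl ∷ _) ∷ _) _ _ = ⊥-elim (no-third-copy m ⊆-triple rest↭)
classify m (a ∷ []) [] z rest↭ _ z↘ _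
  with refl ← nonIncreasing-↭-unique z↘ (nonIncreasing-⊆-doubled↓ m (delete-⊆ a _)) (↭-delete rest↭) =
  single (∈-resp-↭ rest↭ (here refl))
classify m (a ∷ []) (b ∷ []) z rest↭ ((refl ∷ []) ∷ _) _ noAbab =
  ⊥-elim (<⇒≢ (s≤s (head-≤ rest↭)) (noAbab (refl ∷ refl ∷ refl ∷ refl ∷ []⊆-universal z)))
classify m (a ∷ []) (b ∷ c ∷ w) z rest↭ ((refl ∷ refl ∷ _) ∷ _) _ _ = ⊥-elim (no-third-copy m ⊆-triple rest↭)
classify m (a ∷ b ∷ []) [] z rest↭ ((refl ∷ []) ∷ _) z↘ _
  with refl ← nonIncreasing-↭-unique z↘ (nonIncreasing-⊆-doubled↓ m (⊆-trans (delete-⊆ a _) (delete-⊆ a _)))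
                (↭-delete (↭-delete rest↭)) =
  double (∈-resp-↭ rest↭ (here refl))
classify m (a ∷ b ∷ []) (c ∷ w) z rest↭ ((refl ∷ refl ∷ _) ∷ _) _ _ = ⊥-elim (no-third-copy m ⊆-triple rest↭)
classify m (a ∷ b ∷ c ∷ u) w z rest↭ ((refl ∷ refl ∷ _) ∷ _) _ _ = ⊥-elim (no-third-copy m ⊆-triple rest↭)

candidate-complete : ∀ m {π} → π ↭ doubled↓ (suc m) → Admissible π → Candidate m π
candidate-complete m π↭ adm with u , w , z , refl , rest↭ ← split-at-max m π↭ =
  classify m u w z rest↭ prefix-constant suffix-nonIncreasing (proj₂ (proj₂ adm))
  where open AroundMax m u w z rest↭ adm

candidate⇔ : ∀ m {π} → Candidate m π ⇔ (π ↭ doubled↓ (suc m) × Admissible π)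
candidate⇔ m = mk⇔ candidate-sound (uncurry (candidate-complete m))

-- Enumeration

candidates : ℕ → List Word
candidates k = doubled↓ (suc (suc k)) ∷ spikeWord k ∷
  map (singleWord (suc k)) (values (suc k)) ++ map (doubleWord (suc k)) (values (suc k))

∈-candidates⇔ : ∀ k {π} → π ∈ candidates k ⇔ Candidate (suc k) π
∈-candidates⇔ k = mk⇔ to from
  where
  m : ℕ
  m = suc k
  to : ∀ {π} → π ∈ candidates k → Candidate m π
  to (here refl) = sorted
  to (there (here refl)) = spike
  to (there (there π∈)) with ∈-++⁻ (map (singleWord m) (values m)) π∈
  ... | inj₁ π∈singles with _ , a∈ , refl ← ∈-map⁻ (singleWord m) π∈singles =
    single (Equivalence.to (∈-values⇔ m) a∈)
  ... | inj₂ π∈doubles with _ , a∈ , refl ← ∈-map⁻ (doubleWord m) π∈doubles =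
    double (Equivalence.to (∈-values⇔ m) a∈)
  from : ∀ {π} → Candidate m π → π ∈ candidates k
  from sorted = here refl
  from spike = there (here refl)
  from (single a∈) =
    there (there (∈-++⁺ˡ (∈-map⁺ (singleWord m) (Equivalence.from (∈-values⇔ m) a∈))))
  from (double a∈) =
    there (there (∈-++⁺ʳ (map (singleWord m) (values m))
                         (∈-map⁺ (doubleWord m) (Equivalence.from (∈-values⇔ m) a∈))))

values-unique : ∀ m → Unique (values m)
values-unique m = Unique.map⁺ suc-injective (Unique.downFrom⁺ m)

length-values : ∀ m → length (values m) ≡ m
length-values m = trans (length-map suc (downFrom m)) (length-downFrom m)

candidates-unique : ∀ k → Unique (candidates k)
candidates-unique k =
  (sorted≢spike ∷ All.tabulate (λ π∈ → not-from-max π∈ ∘ sym)) ∷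
  All.tabulate (λ π∈ → not-from-max π∈ ∘ sym) ∷
  Unique.++⁺ (Unique.map⁺ ∷-injectiveˡ (values-unique m)) (Unique.map⁺ ∷-injectiveˡ (values-unique m))
             single≢double
  where
  m n : ℕ
  m = suc k
  n = suc m
  below : ∀ {a} → a ∈ values m → a ≢ n
  below a∈ = <⇒≢ (s≤s (∈-doubled↓⇒≤ m (Equivalence.to (∈-values⇔ m) a∈)))
  sorted≢spike : doubled↓ n ≢ spikeWord k
  sorted≢spike eq = 1+n≢n (∷-injectiveˡ (∷-injectiveʳ eq))
  not-from-max : ∀ {π t} → π ∈ map (singleWord m) (values m) ++ map (doubleWord m) (values m) → π ≢ n ∷ t
  not-from-max π∈ with ∈-++⁻ (map (singleWord m) (values m)) π∈
  ... | inj₁ π∈singles with _ , a∈ , refl ← ∈-map⁻ (singleWord m) π∈singles = below a∈ ∘ ∷-injectiveˡ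
  ... | inj₂ π∈doubles with _ , a∈ , refl ← ∈-map⁻ (doubleWord m) π∈doubles = below a∈ ∘ ∷-injectiveˡ
  single≢double : ∀ {π} → ¬ (π ∈ map (singleWord m) (values m) × π ∈ map (doubleWord m) (values m))
  single≢double (π∈singles , π∈doubles)
    with _ , _ , refl ← ∈-map⁻ (singleWord m) π∈singles
    with _ , b∈ , eq ← ∈-map⁻ (doubleWord m) π∈doubles = below b∈ (sym (∷-injectiveˡ (∷-injectiveʳ eq)))

length-candidates : ∀ k → length (candidates k) ≡ 2 * suc (suc k)
length-candidates k = begin
  length (candidates k)
    ≡⟨ cong (suc ∘ suc) (length-++ (map (singleWord m) (values m))) ⟩
  2 + (length (map (singleWord m) (values m)) + length (map (doubleWord m) (values m)))
    ≡⟨ cong (suc ∘ suc) (cong₂ _+_ (length-values′ (singleWord m)) (length-values′ (doubleWord m))) ⟩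
  2 + (m + m)
    ≡⟨ arithmetic m ⟩
  2 * suc m ∎
  where
  open ≡-Reasoning
  m : ℕ
  m = suc k
  length-values′ : (f : ℕ → Word) → length (map f (values m)) ≡ m
  length-values′ f = trans (length-map f (values m)) (length-values m)
  arithmetic : ∀ m → 2 + (m + m) ≡ 2 * suc m
  arithmetic = solve-∀

qs-avoiding⇔ : ∀ n {π} → QS-Avoiding n (p123 ∷ p213 ∷ p312 ∷ []) π ⇔ (π ↭ doubled↓ n × Admissible π)
qs-avoiding⇔ n = mk⇔ to from
  where
  to : ∀ {π} → QS-Avoiding n (p123 ∷ p213 ∷ p312 ∷ []) π → π ↭ doubled↓ n × Admissible π
  to ((π↭ , av1212 , av2121) , av) =
    ↭-trans π↭ (doubled↭doubled↓ n) ,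
    avoids⇒no123-213 (av #0) (av #1) ,
    avoids⇒no312 (av #2) ,
    avoids⇒noAbab av1212 av2121
  from : ∀ {π} → π ↭ doubled↓ n × Admissible π → QS-Avoiding n (p123 ∷ p213 ∷ p312 ∷ []) π
  from (π↭ , free123 , free312 , freeAbab) =
    (↭-trans π↭ (↭-sym (doubled↭doubled↓ n)) , noAbab⇒avoids1212 freeAbab , noAbab⇒avoids2121 freeAbab) ,
    λ { #0 → no123-213⇒avoids123 free123
      ; #1 → no123-213⇒avoids213 free123
      ; #2 → no312⇒avoids312 free312
      ; (there (there (there ()))) }

theorem4p10 : ∀ (n : ℕ) → 2 ≤ n →
    HasCard (QS-Avoiding n (p123 ∷ p213 ∷ p312 ∷ [])) (2 * n)
theorem4p10 zero ()
theorem4p10 (suc zero) (s≤s ())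
theorem4p10 (suc (suc k)) _ =
  candidates k ,
  candidates-unique k ,
  (λ _ → ⇔-sym (qs-avoiding⇔ (suc (suc k))) ⇔-∘ (candidate⇔ (suc k) ⇔-∘ ∈-candidates⇔ k)) ,
  length-candidates k
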